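{- Let $n\ge 1$ and let $\sigma,\sigma'\in S_n$ have reduced word expressions $\sigma=s_{k_1}s_{k_2}\cdots s_{k_l}$ and $\sigma'=s_{n-k_1}s_{n-k_2}\cdots s_{n-k_l}$. Then $|C_\sigma|=|C_{\sigma'}|$, i.e. the number of $\tau\in S_n$ for which $C_{(\sigma,\tau)}$ is the label sequence of a falling maximal chain of $\mathcal{P}_n$ equals the number of $\tau\in S_n$ for which $C_{(\sigma',\tau)}$ is.
   Context: $s_i$ denotes the simple transposition $(i\ i+1)$ in $S_n$. Identify a monotone lattice path from $(0,0)$ to $(n-k,k)$ with the $k$-subset of $[n]$ of positions of its North steps. For $k$-subsets $U=\{u_1<\dots<u_k\}$, $L=\{\ell_1<\dots<\ell_k\}$ of $[n]$ with $u_i\le\ell_i$ for all $i$, the lattice path matroid $M[U,L]$ is the matroid on $[n]$ whose bases are the $k$-sets $\{b_1<\dots<b_k\}$ with $u_i\le b_i\le\ell_i$. $\mathcal{P}_n$ is the poset of all lattice path matroids on $[n]$ ordered by the matroid quotient relation ($M'\le_q M$ iff there is a matroid $N$ on $[n]\sqcup T$ with $M=N\setminus T$, $M'=N/T$). Known: $M[U',L']\le_q M[U,L]$ iff $U'\subseteq U$, $L'\subseteq L$ and the greedy pairing is good, where: $(\ell_i,u_j)$ is a good pair of $M[U,L]$ if $i\le j$ and $u_j-\ell_i\le j-i$; with $U\setminus U'=\{a_1<\dots<a_z\}$, $L\setminus L'=\{b_1<\dots<b_z\}$, the greedy pairing $((b_1,a_1),\dots,(b_z,a_z))$ is good if each $(b_r,a_r)$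 is a good pair of $M[U\setminus\{a_1,\dots,a_{r-1}\},L\setminus\{b_1,\dots,b_{r-1}\}]$. Covers $M[U\setminus\{u\},L\setminus\{\ell\}]\lessdot M[U,L]$ are labeled $(\ell,u)$. A maximal chain $M[\emptyset,\emptyset]=M_0\lessdot\cdots\lessdot M_n=M[[n],[n]]$ has label sequence $((\ell_1,u_1),\dots,(\ell_n,u_n))$ with $(\ell_i,u_i)=\lambda(M_{i-1}\lessdot M_i)$, and is falling if for each $1\le i<n$ it is not the case that both $\ell_i<\ell_{i+1}$ and $u_i<u_{i+1}$. For $\sigma,\tau\in S_n$, $C_{(\sigma,\tau)}=((\sigma(1),\tau(1)),\dots,(\sigma(n),\tau(n)))$, and $C_\sigma$ is the set of those $C_{(\sigma,\tau)}$, $\tau\in S_n$, that are label sequences of falling maximal chains of $\mathcal{P}_n$. -}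

module Defs where

open import Level using (0ℓ)
open import Data.Nat as ℕ using (ℕ; zero; suc; _+_; _∸_)
open import Data.Bool using (Bool; true; false; if_then_else_)
open import Data.Fin as Fin using (Fin; toℕ)
open import Data.Fin.Subset using (Subset; ⊥; ⊤; _∈_; _∉_; _-_; _∪_; ⁅_⁆; ∣_∣)
open import Data.Vec as Vec using (Vec; []; _∷_; lookup; take; drop)
open import Data.List as List using (List; []; _∷_; length; map)
open import Data.List.Relation.Binary.Pointwise using (Pointwise)
open import Data.List.Relation.Unary.All using (All)
open import Data.Product using (Σ; ∃; _×_; _,_)
open import Relation.Nullary using (¬_)
open import Relation.Binary.PropositionalEquality using (_≡_)

-- Conventions: the ground set [n] = {1,…,n} is represented by Fin n,
-- the element i ∈ [n] being the Fin value i-1 (an order-preserving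
-- relabelling).  Subsets of [n] are Data.Fin.Subset.

elems : ∀ {n} → Subset n → List (Fin n)
elems [] = []
elems (true ∷ p) = Fin.zero ∷ map Fin.suc (elems p)
elems (false ∷ p) = map Fin.suc (elems p)

record Matroid (m : ℕ) : Set₁ where
  field
    IsBasis  : Subset m → Set
    nonempty : ∃ IsBasis
    exchange : ∀ B₁ B₂ → IsBasis B₁ → IsBasis B₂ → ∀ x → x ∈ B₁ → x ∉ B₂ →
               Σ (Fin m) λ y → y ∈ B₂ × y ∉ B₁ × IsBasis ((B₁ - x) ∪ ⁅ y ⁆)
open Matroid public

-- For N a matroid on [n] ⊔ T, with T = Fin t represented as the last
-- t elements of Fin (n + t):
-- the bases of the deletion N \ T are the sets B ∩ [n] (B a basis of N)
-- with |B ∩ [n]| maximal;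
DeletionBasis : ∀ {n t} → Matroid (n + t) → Subset n → Set
DeletionBasis {n} N X = Σ (Subset _) λ B → IsBasis N B × take n B ≡ X ×
  (∀ B′ → IsBasis N B′ → ∣ take n B′ ∣ ℕ.≤ ∣ take n B ∣)

ContractionBasis : ∀ {n t} → Matroid (n + t) → Subset n → Set
ContractionBasis {n} N X = Σ (Subset _) λ B → IsBasis N B × take n B ≡ X ×
  (∀ B′ → IsBasis N B′ → ∣ drop n B′ ∣ ℕ.≤ ∣ drop n B ∣)

_≼_ : ∀ {n} → Subset n → Subset n → Set
U ≼ L = Pointwise Fin._≤_ (elems U) (elems L)

record LPM (n : ℕ) : Set where
  constructor M[_,_]⟨_⟩
  field
    U L   : Subset n
    U≼L  : U ≼ L
open LPM public

LPMBasis : ∀ {n} → LPM n → Subset n → Set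
LPMBasis M B = U M ≼ B × B ≼ L M

-- the matroid quotient relation M′ ≤_q M: there is a matroid N on
-- [n] ⊔ T with M = N \ T and M′ = N / T (equality of matroids on [n]
-- = same bases).
_≤q_ : ∀ {n} → LPM n → LPM n → Set₁
_≤q_ {n} M′ M = Σ ℕ λ t → Σ (Matroid (n + t)) λ N →
  (∀ X → (LPMBasis M X → DeletionBasis N X) × (DeletionBasis N X → LPMBasis M X)) ×
  (∀ X → (LPMBasis M′ X → ContractionBasis N X) × (ContractionBasis N X → LPMBasis M′ X))

-- equality of elements of 𝒫ₙ (M[U,L] determines (U,L): U resp. L is
-- its lexicographically smallest resp. largest basis)
_≈M_ : ∀ {n} → LPM n → LPM n → Set
M ≈M M′ = U M ≡ U M′ × L M ≡ L M′

_⋖_ : ∀ {n} → LPM n → LPM n → Set₁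
M′ ⋖ M = M′ ≤q M × ¬ (M′ ≈M M) ×
  (∀ M″ → M′ ≤q M″ → M″ ≤q M → M″ ≈M M′ ⊎′ M″ ≈M M)
  where
  open import Data.Sum using () renaming (_⊎_ to _⊎′_)

-- Falling maximal chains with label sequence C_(σ,τ).
-- Permutations of [n] are vectors (one-line notation), σ(i) = lookup σ i.

IsPerm : ∀ {n} → Vec (Fin n) n → Set
IsPerm {n} τ = ∀ i j → lookup τ i ≡ lookup τ j → i ≡ j

-- M_0 ⋖ M_1 ⋖ ⋯ ⋖ M_n is a maximal chain of 𝒫ₙ from M[∅,∅] to
-- M[[n],[n]] whose i-th cover M_{i-1} ⋖ M_i is labelled (σ(i),τ(i)),
-- i.e. M_{i-1} = M[U_i \ {τ(i)}, L_i \ {σ(i)}] where M_i = M[U_i,L_i].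
IsChainWithLabels : ∀ {n} → Vec (Fin n) n → Vec (Fin n) n → (Fin (suc n) → LPM n) → Set₁
IsChainWithLabels {n} σ τ M =
  (M Fin.zero ≈M M[ ⊥ , ⊥ ]⟨ botOK ⟩) ×
  (M (Fin.fromℕ n) ≈M M[ ⊤ , ⊤ ]⟨ topOK ⟩) ×
  (∀ (i : Fin n) →
     M (Fin.inject₁ i) ⋖ M (Fin.suc i) ×
     lookup τ i ∈ U (M (Fin.suc i)) × lookup σ i ∈ L (M (Fin.suc i)) ×
     U (M (Fin.inject₁ i)) ≡ U (M (Fin.suc i)) - lookup τ i ×
     L (M (Fin.inject₁ i)) ≡ L (M (Fin.suc i)) - lookup σ i)
  where
  refl≼ : ∀ {m} (X : Subset m) → X ≼ X
  refl≼ X = Data.List.Relation.Binary.Pointwise.refl Data.Fin.Properties.≤-refl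
    where
    import Data.List.Relation.Binary.Pointwise
    import Data.Fin.Properties
  botOK = refl≼ ⊥
  topOK = refl≼ ⊤

-- falling: for no 1 ≤ i < n do both ℓ_i < ℓ_{i+1} and u_i < u_{i+1} hold
Falling : ∀ {n} → Vec (Fin n) n → Vec (Fin n) n → Set
Falling {n} σ τ = ∀ (i j : Fin n) → suc (toℕ i) ≡ toℕ j →
  ¬ (lookup σ i Fin.< lookup σ j × lookup τ i Fin.< lookup τ j)

InCσ : ∀ {n} → Vec (Fin n) n → Vec (Fin n) n → Set₁
InCσ σ τ = Falling σ τ × Σ _ (IsChainWithLabels σ τ)

-- Simple transpositions and reduced words.
-- s_k (1 ≤ k ≤ n-1) swaps the 1-based values k and k+1, i.e. the
-- 0-based values k-1 and k; we let it act on ℕ (fixing everything else).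

s : ℕ → ℕ → ℕ
s k x = if x + 1 ℕ.≡ᵇ k then k else (if x ℕ.≡ᵇ k then k ∸ 1 else x)

word : List ℕ → ℕ → ℕ
word [] x = x
word (k ∷ ks) x = s k (word ks x)

ValidWord : ℕ → List ℕ → Set
ValidWord n w = All (λ k → 1 ℕ.≤ k × k ℕ.< n) w

ReducedWordFor : ∀ {n} → List ℕ → Vec (Fin n) n → Set
ReducedWordFor {n} w σ =
  ValidWord n w ×
  (∀ i → toℕ (lookup σ i) ≡ word w (toℕ i)) ×
  (∀ w′ → ValidWord n w′ → (∀ x → x ℕ.< n → word w′ x ≡ word w x) →
     length w ℕ.≤ length w′)

flipWord : ℕ → List ℕ → List ℕ
flipWord n w = map (n ∸_) w

{-# OPTIONS --safe #-}
-- The complement-reversal X ↦ ∁ (reverse X) preserves the order ≼ of lattice paths (it turns a pair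
-- of paths by a half turn and swaps north and east steps), so M[U,L] ↦ M[∁ (reverse U), ∁ (reverse L)],
-- the dual of the reversed matroid, is an involution of 𝒫ₙ. It reverses ≤q: if N on [n] ⊔ T has
-- N \ T = M and N / T = M′, then the dual of N with [n] reversed has deletion the image of M′ and
-- contraction the image of M, because duality exchanges deletion and contraction. Hence it turns a
-- maximal chain with labels (σ(i), τ(i)), read backwards, into one with labels (w₀σw₀(i), w₀τw₀(i)),
-- and keeps it falling, since both positions and label values get reversed. Finally w₀ s_k w₀ = s_{n−k},
-- so σ′ = w₀σw₀ and τ ↦ w₀τw₀ is the required bijection.
module Submission where

open import Defs
open import Data.Nat using (ℕ; _≤_)
open import Data.Fin using (Fin)
open import Data.Vec using (Vec)
open import Data.List using (List)
open import Data.Product using (Σ; _×_)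
open import Relation.Binary.PropositionalEquality using (_≡_)

open import Data.Nat as ℕ using (zero; suc; _+_; _∸_; _<_; z≤n; s≤s)
import Data.Nat.Properties as ℕ
import Data.Nat.Induction as ℕ
open import Data.Bool using (Bool; true; false; not)
import Data.Bool.Properties as Bool
open import Data.Fin as Fin using (toℕ; opposite; _↑ˡ_; _↑ʳ_)
import Data.Fin.Properties as Fin
open import Data.Fin.Subset
import Data.Fin.Subset.Properties as Subset
open import Data.Vec as Vec using ([]; _∷_; here; there; lookup; tabulate; take; drop; reverse; _∷ʳ_)
import Data.Vec.Properties as Vec
open import Data.List as List using ([]; _∷_; _++_)
import Data.List.Properties as List
open import Data.List.Relation.Binary.Pointwise as Pointwise using (Pointwise; []; _∷_)
open import Data.List.Relation.Unary.All using ([]; _∷_)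
open import Data.Product using (_,_; proj₁; proj₂)
open import Data.Sum as Sum using (_⊎_; inj₁; inj₂)
open import Data.Empty using (⊥-elim)
open import Function using (_∘_; id)
open import Function.Bundles using (_⇔_; mk⇔; Equivalence)
open import Induction.WellFounded using (Acc; acc)
open import Relation.Nullary using (¬_; yes; no)
open import Relation.Nullary.Decidable using (dec-true; dec-false)
open import Relation.Binary.PropositionalEquality

private variable
  m n : ℕ


lookup-injective : ∀ {a} {A : Set a} {p q : Vec A n} → (∀ i → lookup p i ≡ lookup q i) → p ≡ q
lookup-injective {p = p} {q} eq = begin
  p                   ≡⟨ Vec.tabulate∘lookup p ⟨
  tabulate (lookup p) ≡⟨ Vec.tabulate-cong eq ⟩
  tabulate (lookup q) ≡⟨ Vec.tabulate∘lookup q ⟩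
  q                   ∎
  where open ≡-Reasoning

∁-involutive : (p : Subset n) → ∁ (∁ p) ≡ p
∁-involutive p = begin
  Vec.map not (Vec.map not p) ≡⟨ Vec.map-∘ not not p ⟨
  Vec.map (not ∘ not) p      ≡⟨ Vec.map-cong Bool.not-involutive p ⟩
  Vec.map id p               ≡⟨ Vec.map-id p ⟩
  p                          ∎
  where open ≡-Reasoning

x∈p─q⁻ : ∀ {x : Fin n} (p q : Subset n) → x ∈ p ─ q → x ∈ p × x ∉ q
x∈p─q⁻ (true ∷ p) (false ∷ q) here = here , λ ()
x∈p─q⁻ {x = Fin.zero} (_ ∷ p) (true ∷ q) ()
x∈p─q⁻ {x = Fin.zero} (false ∷ p) (false ∷ q) ()
x∈p─q⁻ (_ ∷ p) (_ ∷ q) (there x∈p─q) with x∈p─q⁻ p q x∈p─q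
... | x∈p , x∉q = there x∈p , x∉q ∘ Subset.drop-there

p─q-empty⇒p⊆q : ∀ (p q : Subset n) → Empty (p ─ q) → p ⊆ q
p─q-empty⇒p⊆q p q empty {x} x∈p with x Subset.∈? q
... | yes x∈q = x∈q
... | no  x∉q = ⊥-elim (empty (x , Subset.x∈p∧x∉q⇒x∈p─q x∈p x∉q))

∈-exchange⁻ : ∀ {A : Subset n} {x y z} → z ∈ (A - x) ∪ ⁅ y ⁆ → (z ∈ A × z ≢ x) ⊎ z ≡ y
∈-exchange⁻ {A = A} {x} {y} z∈ with Subset.x∈p∪q⁻ (A - x) ⁅ y ⁆ z∈
... | inj₁ z∈A-x = let z∈A , z∉x = x∈p─q⁻ A ⁅ x ⁆ z∈A-x in inj₁ (z∈A , Subset.x∉⁅y⁆⇒x≢y z∉x)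
... | inj₂ z∈y   = inj₂ (Subset.x∈⁅y⁆⇒x≡y y z∈y)

∈-exchange⁺ : ∀ {A : Subset n} {x y z} → (z ∈ A × z ≢ x) ⊎ z ≡ y → z ∈ (A - x) ∪ ⁅ y ⁆
∈-exchange⁺ (inj₁ (z∈A , z≢x)) = Subset.x∈p∪q⁺ (inj₁ (Subset.x∈p∧x≢y⇒x∈p-y z∈A z≢x))
∈-exchange⁺ {y = y} (inj₂ refl) = Subset.x∈p∪q⁺ (inj₂ (Subset.x∈⁅x⁆ y))

∁-exchange : ∀ {A : Subset n} {x y} → x ∈ A → y ∉ A → ∁ ((A - x) ∪ ⁅ y ⁆) ≡ (∁ A - y) ∪ ⁅ x ⁆
∁-exchange {A = A} {x} {y} x∈A y∉A = Subset.⊆-antisym forth back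
  where
  forth : ∁ ((A - x) ∪ ⁅ y ⁆) ⊆ (∁ A - y) ∪ ⁅ x ⁆
  forth {z} z∈ with z Fin.≟ x
  ... | yes z≡x = ∈-exchange⁺ (inj₂ z≡x)
  ... | no  z≢x = ∈-exchange⁺ (inj₁ (Subset.x∉p⇒x∈∁p z∉A , z≢y))
    where
    z∉A : z ∉ A
    z∉A z∈A = Subset.x∈∁p⇒x∉p z∈ (∈-exchange⁺ (inj₁ (z∈A , z≢x)))
    z≢y : z ≢ y
    z≢y z≡y = Subset.x∈∁p⇒x∉p z∈ (∈-exchange⁺ (inj₂ z≡y))
  back : (∁ A - y) ∪ ⁅ x ⁆ ⊆ ∁ ((A - x) ∪ ⁅ y ⁆)
  back {z} z∈ = Subset.x∉p⇒x∈∁p (λ z∈′ → case z∈ z∈′)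
    where
    case : z ∈ (∁ A - y) ∪ ⁅ x ⁆ → z ∉ (A - x) ∪ ⁅ y ⁆
    case z∈ z∈′ with ∈-exchange⁻ {A = ∁ A} z∈ | ∈-exchange⁻ {A = A} z∈′
    ... | inj₁ (z∈∁A , _)   | inj₁ (z∈A , _)   = Subset.x∈∁p⇒x∉p z∈∁A z∈A
    ... | inj₁ (_ , z≢y)    | inj₂ z≡y         = z≢y z≡y
    ... | inj₂ refl         | inj₁ (_ , x≢x)   = x≢x refl
    ... | inj₂ refl         | inj₂ refl        = y∉A x∈A

suc∣p-x∣≡∣p∣ : ∀ {x : Fin n} (p : Subset n) → x ∈ p → suc ∣ p - x ∣ ≡ ∣ p ∣
suc∣p-x∣≡∣p∣ (true ∷ p) here = cong (suc ∘ ∣_∣) (Subset.p─⊥≡p p)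
suc∣p-x∣≡∣p∣ (true ∷ p) (there x∈p) = cong suc (suc∣p-x∣≡∣p∣ p x∈p)
suc∣p-x∣≡∣p∣ (false ∷ p) (there x∈p) = suc∣p-x∣≡∣p∣ p x∈p

∣p∪⁅x⁆∣≡suc∣p∣ : ∀ {x : Fin n} (p : Subset n) → x ∉ p → ∣ p ∪ ⁅ x ⁆ ∣ ≡ suc ∣ p ∣
∣p∪⁅x⁆∣≡suc∣p∣ {x = Fin.zero} (true ∷ p) x∉p = ⊥-elim (x∉p here)
∣p∪⁅x⁆∣≡suc∣p∣ {x = Fin.zero} (false ∷ p) x∉p = cong (suc ∘ ∣_∣) (Subset.∪-identityʳ p)
∣p∪⁅x⁆∣≡suc∣p∣ {x = Fin.suc x} (true ∷ p) x∉p = cong suc (∣p∪⁅x⁆∣≡suc∣p∣ p (x∉p ∘ there))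
∣p∪⁅x⁆∣≡suc∣p∣ {x = Fin.suc x} (false ∷ p) x∉p = ∣p∪⁅x⁆∣≡suc∣p∣ p (x∉p ∘ there)

∣exchange∣ : ∀ {A : Subset n} {x y} → x ∈ A → y ∉ A → ∣ (A - x) ∪ ⁅ y ⁆ ∣ ≡ ∣ A ∣
∣exchange∣ {A = A} {x} x∈A y∉A =
  trans (∣p∪⁅x⁆∣≡suc∣p∣ (A - x) (y∉A ∘ proj₁ ∘ x∈p─q⁻ A ⁅ x ⁆)) (suc∣p-x∣≡∣p∣ A x∈A)

exchange-─-⊂ : ∀ {A B : Subset n} {x y} → x ∈ A → x ∉ B → y ∈ B →
               ((A - x) ∪ ⁅ y ⁆) ─ B ⊂ A ─ B
exchange-─-⊂ {A = A} {B} {x} {y} x∈A x∉B y∈B = shrinks , x , Subset.x∈p∧x∉q⇒x∈p─q x∈A x∉B , x∉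
  where
  shrinks : ((A - x) ∪ ⁅ y ⁆) ─ B ⊆ A ─ B
  shrinks z∈ with x∈p─q⁻ _ B z∈
  ... | z∈A′ , z∉B with ∈-exchange⁻ z∈A′
  ... | inj₁ (z∈A , _) = Subset.x∈p∧x∉q⇒x∈p─q z∈A z∉B
  ... | inj₂ refl      = ⊥-elim (z∉B y∈B)
  x∉ : x ∉ ((A - x) ∪ ⁅ y ⁆) ─ B
  x∉ x∈ with ∈-exchange⁻ (proj₁ (x∈p─q⁻ _ B x∈))
  ... | inj₁ (_ , x≢x) = x≢x refl
  ... | inj₂ refl      = x∉B y∈B

∣take∣+∣drop∣ : ∀ m (p : Subset (m + n)) → ∣ p ∣ ≡ ∣ take m p ∣ + ∣ drop m p ∣
∣take∣+∣drop∣ zero    p           = refl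
∣take∣+∣drop∣ (suc m) (true ∷ p)  = cong suc (∣take∣+∣drop∣ m p)
∣take∣+∣drop∣ (suc m) (false ∷ p) = ∣take∣+∣drop∣ m p

module _ {a} {A : Set a} where

  lookup-take : ∀ m (xs : Vec A (m + n)) i → lookup (take m xs) i ≡ lookup xs (i ↑ˡ n)
  lookup-take m xs i = trans (sym (Vec.lookup-++ˡ (take m xs) (drop m xs) i))
                             (cong (λ ys → lookup ys (i ↑ˡ _)) (Vec.take++drop≡id m xs))

  lookup-drop : ∀ m (xs : Vec A (m + n)) i → lookup (drop m xs) i ≡ lookup xs (m ↑ʳ i)
  lookup-drop m xs i = trans (sym (Vec.lookup-++ʳ (take m xs) (drop m xs) i))
                             (cong (λ ys → lookup ys (m ↑ʳ i)) (Vec.take++drop≡id m xs))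

  lookup-∷ʳ-last : ∀ (xs : Vec A n) x → lookup (xs ∷ʳ x) (Fin.fromℕ n) ≡ x
  lookup-∷ʳ-last []       x = refl
  lookup-∷ʳ-last (_ ∷ xs) x = lookup-∷ʳ-last xs x

  lookup-∷ʳ-inject₁ : ∀ (xs : Vec A n) x i → lookup (xs ∷ʳ x) (Fin.inject₁ i) ≡ lookup xs i
  lookup-∷ʳ-inject₁ (_ ∷ xs) x Fin.zero    = refl
  lookup-∷ʳ-inject₁ (_ ∷ xs) x (Fin.suc i) = lookup-∷ʳ-inject₁ xs x i

  lookup-reverse-opposite : ∀ (xs : Vec A n) i → lookup (reverse xs) (opposite i) ≡ lookup xs i
  lookup-reverse-opposite (x ∷ xs) i rewrite Vec.reverse-∷ x xs with i
  ... | Fin.zero  = lookup-∷ʳ-last (reverse xs) x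
  ... | Fin.suc i = trans (lookup-∷ʳ-inject₁ (reverse xs) x (opposite i)) (lookup-reverse-opposite xs i)

  lookup-reverse : ∀ (xs : Vec A n) i → lookup (reverse xs) i ≡ lookup xs (opposite i)
  lookup-reverse xs i = trans (cong (lookup (reverse xs)) (sym (Fin.opposite-involutive i)))
                              (lookup-reverse-opposite xs (opposite i))

reverse-replicate : ∀ {a} {A : Set a} (x : A) → reverse (Vec.replicate n x) ≡ Vec.replicate n x
reverse-replicate {n} x = lookup-injective λ i →
  trans (lookup-reverse (Vec.replicate n x) i) (trans (Vec.lookup-replicate (opposite i) x) (sym (Vec.lookup-replicate i x)))

∣p∷ʳx∣ : (p : Subset n) (x : Bool) → ∣ p ∷ʳ x ∣ ≡ ∣ x ∷ p ∣
∣p∷ʳx∣ []          x     = refl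
∣p∷ʳx∣ (true ∷ p)  true  = cong suc (∣p∷ʳx∣ p true)
∣p∷ʳx∣ (true ∷ p)  false = cong suc (∣p∷ʳx∣ p false)
∣p∷ʳx∣ (false ∷ p) x     = ∣p∷ʳx∣ p x

∣reverse∣ : (p : Subset n) → ∣ reverse p ∣ ≡ ∣ p ∣
∣reverse∣ []          = refl
∣reverse∣ (true ∷ p)  =
  trans (cong ∣_∣ (Vec.reverse-∷ true p)) (trans (∣p∷ʳx∣ (reverse p) true) (cong suc (∣reverse∣ p)))
∣reverse∣ (false ∷ p) =
  trans (cong ∣_∣ (Vec.reverse-∷ false p)) (trans (∣p∷ʳx∣ (reverse p) false) (∣reverse∣ p))

x∈reverse⁺ : ∀ {p : Subset n} {x} → opposite x ∈ p → x ∈ reverse p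
x∈reverse⁺ {p = p} {x} ox∈p = Vec.lookup⇒[]= x (reverse p) (trans (lookup-reverse p x) (Vec.[]=⇒lookup ox∈p))

x∈reverse⁻ : ∀ {p : Subset n} {x} → x ∈ reverse p → opposite x ∈ p
x∈reverse⁻ {p = p} {x} x∈ = Vec.lookup⇒[]= (opposite x) p (trans (sym (lookup-reverse p x)) (Vec.[]=⇒lookup x∈))

preimage : (Fin n → Fin n) → Subset n → Subset n
preimage f p = tabulate (lookup p ∘ f)

module _ (f : Fin n → Fin n) (p : Subset n) {x : Fin n} where

  x∈preimage⁺ : f x ∈ p → x ∈ preimage f p
  x∈preimage⁺ fx∈p = Vec.lookup⇒[]= x (preimage f p) (trans (Vec.lookup∘tabulate _ x) (Vec.[]=⇒lookup fx∈p))

  x∈preimage⁻ : x ∈ preimage f p → f x ∈ p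
  x∈preimage⁻ x∈ = Vec.lookup⇒[]= (f x) p (trans (sym (Vec.lookup∘tabulate _ x)) (Vec.[]=⇒lookup x∈))

module _ {ρ : Fin n → Fin n} (ρ-involutive : ∀ x → ρ (ρ x) ≡ x) where

  preimage-involutive : (p : Subset n) → preimage ρ (preimage ρ p) ≡ p
  preimage-involutive p = lookup-injective λ i → begin
    lookup (preimage ρ (preimage ρ p)) i ≡⟨ Vec.lookup∘tabulate _ i ⟩
    lookup (preimage ρ p) (ρ i)          ≡⟨ Vec.lookup∘tabulate _ (ρ i) ⟩
    lookup p (ρ (ρ i))                   ≡⟨ cong (lookup p) (ρ-involutive i) ⟩
    lookup p i                           ∎
    where open ≡-Reasoning

  ρ-injective : ∀ {x y} → ρ x ≡ ρ y → x ≡ y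
  ρ-injective {x} {y} ρx≡ρy = trans (sym (ρ-involutive x)) (trans (cong ρ ρx≡ρy) (ρ-involutive y))

  preimage-exchange : ∀ (A : Subset n) x y →
                      preimage ρ ((A - x) ∪ ⁅ ρ y ⁆) ≡ (preimage ρ A - ρ x) ∪ ⁅ y ⁆
  preimage-exchange A x y = Subset.⊆-antisym forth back
    where
    forth : preimage ρ ((A - x) ∪ ⁅ ρ y ⁆) ⊆ (preimage ρ A - ρ x) ∪ ⁅ y ⁆
    forth {z} z∈ with ∈-exchange⁻ {A = A} (x∈preimage⁻ ρ ((A - x) ∪ ⁅ ρ y ⁆) z∈)
    ... | inj₁ (ρz∈A , ρz≢x) =
      ∈-exchange⁺ (inj₁ (x∈preimage⁺ ρ A ρz∈A , λ { refl → ρz≢x (ρ-involutive x) }))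
    ... | inj₂ ρz≡ρy         = ∈-exchange⁺ (inj₂ (ρ-injective ρz≡ρy))
    back : (preimage ρ A - ρ x) ∪ ⁅ y ⁆ ⊆ preimage ρ ((A - x) ∪ ⁅ ρ y ⁆)
    back {z} z∈ = x∈preimage⁺ ρ ((A - x) ∪ ⁅ ρ y ⁆) (∈-exchange⁺ (case (∈-exchange⁻ z∈)))
      where
      case : (z ∈ preimage ρ A × z ≢ ρ x) ⊎ z ≡ y → (ρ z ∈ A × ρ z ≢ x) ⊎ ρ z ≡ ρ y
      case (inj₁ (z∈ , z≢ρx)) = inj₁ (x∈preimage⁻ ρ A z∈ , λ { refl → z≢ρx (sym (ρ-involutive z)) })
      case (inj₂ z≡y)         = inj₂ (cong ρ z≡y)

preimage-∁ : ∀ (f : Fin n → Fin n) p → preimage f (∁ p) ≡ ∁ (preimage f p)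
preimage-∁ f p = trans (Vec.tabulate-cong (λ i → Vec.lookup-map (f i) not p)) (Vec.tabulate-∘ not (lookup p ∘ f))


∁reverse : Subset n → Subset n
∁reverse p = ∁ (reverse p)

∁reverse-involutive : (p : Subset n) → ∁reverse (∁reverse p) ≡ p
∁reverse-involutive p = begin
  ∁ (reverse (∁ (reverse p))) ≡⟨ cong (∁ ∘ reverse) (Vec.map-reverse not p) ⟩
  ∁ (reverse (reverse (∁ p))) ≡⟨ cong ∁ (Vec.reverse-involutive (∁ p)) ⟩
  ∁ (∁ p)                     ≡⟨ ∁-involutive p ⟩
  p                           ∎
  where open ≡-Reasoning

∁reverse-swap : ∀ {p q : Subset n} → ∁reverse p ≡ q → p ≡ ∁reverse q
∁reverse-swap {p = p} eq = trans (sym (∁reverse-involutive p)) (cong ∁reverse eq)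

∁reverse-∷ : ∀ x (p : Subset n) → ∁reverse (x ∷ p) ≡ ∁reverse p ∷ʳ not x
∁reverse-∷ x p = trans (cong ∁ (Vec.reverse-∷ x p)) (Vec.map-∷ʳ not x (reverse p))

∁reverse-replicate : ∀ b → ∁reverse (Vec.replicate n b) ≡ Vec.replicate n (not b)
∁reverse-replicate {n} b = trans (cong ∁ (reverse-replicate b)) (Vec.map-replicate not b n)

x∈∁reverse⁺ : ∀ {p : Subset n} {x} → opposite x ∉ p → x ∈ ∁reverse p
x∈∁reverse⁺ ox∉p = Subset.x∉p⇒x∈∁p (ox∉p ∘ x∈reverse⁻)

x∈∁reverse⁻ : ∀ {p : Subset n} {x} → x ∈ ∁reverse p → opposite x ∉ p
x∈∁reverse⁻ x∈ = Subset.x∈∁p⇒x∉p x∈ ∘ x∈reverse⁺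

∁reverse-step : ∀ {S S′ : Subset n} {x} → x ∈ S → S′ ≡ S - x →
                opposite x ∈ ∁reverse S′ × ∁reverse S ≡ ∁reverse S′ - opposite x
∁reverse-step {S = S} {x = x} x∈S refl = x∈∁reverse⁺ ox∉S-x , Subset.⊆-antisym forth back
  where
  ox∉S-x : opposite (opposite x) ∉ S - x
  ox∉S-x ox∈ =
    proj₂ (x∈p─q⁻ S ⁅ x ⁆ ox∈) (subst (_∈ ⁅ x ⁆) (sym (Fin.opposite-involutive x)) (Subset.x∈⁅x⁆ x))
  forth : ∁reverse S ⊆ ∁reverse (S - x) - opposite x
  forth {z} z∈ = Subset.x∈p∧x≢y⇒x∈p-y (x∈∁reverse⁺ (x∈∁reverse⁻ z∈ ∘ Subset.p─q⊆p S ⁅ x ⁆))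
    (λ { refl → x∈∁reverse⁻ z∈ (subst (_∈ S) (sym (Fin.opposite-involutive x)) x∈S) })
  back : ∁reverse (S - x) - opposite x ⊆ ∁reverse S
  back {z} z∈ with x∈p─q⁻ (∁reverse (S - x)) ⁅ opposite x ⁆ z∈
  ... | z∈′ , z∉ox = x∈∁reverse⁺ λ oz∈S →
    x∈∁reverse⁻ {p = S - x} z∈′ (Subset.x∈p∧x≢y⇒x∈p-y oz∈S
        λ { refl → z∉ox (subst (_∈ ⁅ opposite (opposite z) ⁆) (Fin.opposite-involutive z) (Subset.x∈⁅x⁆ _)) })


-- Matroids
module _ (N : Matroid m) where

  ∣basis∣≤∣basis∣ : ∀ {A B} → IsBasis N A → IsBasis N B → ∣ A ∣ ≤ ∣ B ∣
  ∣basis∣≤∣basis∣ {A} {B} bA bB = go A bA (ℕ.<-wellFounded ∣ A ─ B ∣)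
    where
    go : ∀ A → IsBasis N A → Acc _<_ ∣ A ─ B ∣ → ∣ A ∣ ≤ ∣ B ∣
    go A bA (acc smaller) with Subset.nonempty? (A ─ B)
    ... | no empty = Subset.p⊆q⇒∣p∣≤∣q∣ (p─q-empty⇒p⊆q A B empty)
    ... | yes (x , x∈A─B) with x∈p─q⁻ A B x∈A─B
    ... | x∈A , x∉B with exchange N A B bA bB x x∈A x∉B
    ... | y , y∈B , y∉A , bA′ = subst (_≤ ∣ B ∣) (∣exchange∣ x∈A y∉A)
          (go _ bA′ (smaller (Subset.p⊂q⇒∣p∣<∣q∣ (exchange-─-⊂ x∈A x∉B y∈B))))

  bases-equicardinal : ∀ {A B} → IsBasis N A → IsBasis N B → ∣ A ∣ ≡ ∣ B ∣
  bases-equicardinal bA bB = ℕ.≤-antisym (∣basis∣≤∣basis∣ bA bB) (∣basis∣≤∣basis∣ bB bA)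

  -- Exchanging some w ≠ z of B ∖ A for an element of A shrinks B ∖ A while keeping z ∈ B;
  -- once B ∖ A = {z}, exchanging any y ∈ A ∖ B into B can only bring in z.
  coexchange : ∀ {A B} → IsBasis N A → IsBasis N B → ∀ z → z ∈ B → z ∉ A →
               Σ (Fin m) λ y → y ∈ A × y ∉ B × IsBasis N ((A - y) ∪ ⁅ z ⁆)
  coexchange {A} {B} bA bB z z∈B z∉A = go B bB z∈B (ℕ.<-wellFounded ∣ B ─ A ∣)
    where
    go : ∀ B → IsBasis N B → z ∈ B → Acc _<_ ∣ B ─ A ∣ →
         Σ (Fin m) λ y → y ∈ A × y ∉ B × IsBasis N ((A - y) ∪ ⁅ z ⁆)
    go B bB z∈B (acc smaller) with Subset.nonempty? ((B ─ A) - z)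
    ... | yes (w , w∈) with x∈p─q⁻ (B ─ A) ⁅ z ⁆ w∈
    ... | w∈B─A , w∉⁅z⁆ with x∈p─q⁻ B A w∈B─A
    ... | w∈B , w∉A with exchange N B A bB bA w w∈B w∉A
    ... | v , v∈A , v∉B , bB′ =
      shrink (go _ bB′ z∈B′ (smaller (Subset.p⊂q⇒∣p∣<∣q∣ (exchange-─-⊂ w∈B w∉A v∈A))))
      where
      z∈B′ : z ∈ (B - w) ∪ ⁅ v ⁆
      z∈B′ = ∈-exchange⁺ (inj₁ (z∈B , λ { refl → w∉⁅z⁆ (Subset.x∈⁅x⁆ z) }))
      shrink : (Σ (Fin m) λ y → y ∈ A × y ∉ (B - w) ∪ ⁅ v ⁆ × IsBasis N ((A - y) ∪ ⁅ z ⁆)) →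
               Σ (Fin m) λ y → y ∈ A × y ∉ B × IsBasis N ((A - y) ∪ ⁅ z ⁆)
      shrink (y , y∈A , y∉B′ , bA′) =
        y , y∈A , (λ y∈B → y∉B′ (∈-exchange⁺ (inj₁ (y∈B , λ { refl → w∉A y∈A })))) , bA′
    go B bB z∈B _ | no none with exchange N B A bB bA z z∈B z∉A
    ... | y , y∈A , y∉B , _ with exchange N A B bA bB y y∈A y∉B
    ... | u , u∈B , u∉A , bA′ with u Fin.≟ z
    ... | yes refl = y , y∈A , y∉B , bA′
    ... | no  u≢z  = ⊥-elim (none (u , Subset.x∈p∧x≢y⇒x∈p-y (Subset.x∈p∧x∉q⇒x∈p─q u∈B u∉A) u≢z))

dual : Matroid m → Matroid m
dual N = record
  { IsBasis  = IsBasis N ∘ ∁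
  ; nonempty = let B , bB = nonempty N in ∁ B , subst (IsBasis N) (sym (∁-involutive B)) bB
  ; exchange = λ B₁ B₂ b₁ b₂ x x∈B₁ x∉B₂ →
      let y , y∈∁B₁ , y∉∁B₂ , b =
            coexchange N b₁ b₂ x (Subset.x∉p⇒x∈∁p x∉B₂) (Subset.x∈p⇒x∉∁p x∈B₁)
      in y , Subset.x∉∁p⇒x∈p y∉∁B₂ , Subset.x∈∁p⇒x∉p y∈∁B₁ ,
         subst (IsBasis N) (sym (∁-exchange x∈B₁ (Subset.x∈∁p⇒x∉p y∈∁B₁))) b
  }

relabel : (ρ : Fin m → Fin m) → (∀ x → ρ (ρ x) ≡ x) → Matroid m → Matroid m
relabel ρ ρ-involutive N = record
  { IsBasis  = IsBasis N ∘ preimage ρ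
  ; nonempty = let B , bB = nonempty N in
      preimage ρ B , subst (IsBasis N) (sym (preimage-involutive ρ-involutive B)) bB
  ; exchange = λ B₁ B₂ b₁ b₂ x x∈B₁ x∉B₂ →
      let y , y∈ρB₂ , y∉ρB₁ , b = exchange N (preimage ρ B₁) (preimage ρ B₂) b₁ b₂ (ρ x)
                                    (x∈preimage⁺ ρ B₁ (subst (_∈ B₁) (sym (ρ-involutive x)) x∈B₁))
                                    (x∉B₂ ∘ subst (_∈ B₂) (ρ-involutive x) ∘ x∈preimage⁻ ρ B₂)
      in ρ y , x∈preimage⁻ ρ B₂ y∈ρB₂ , y∉ρB₁ ∘ x∈preimage⁺ ρ B₁ ,
         subst (IsBasis N) (sym (preimage-exchange ρ-involutive B₁ x y)) b
  }

reverseˡ : ∀ n {t} → Fin (n + t) → Fin (n + t)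
reverseˡ n {t} = Fin.join n t ∘ Sum.map₁ opposite ∘ Fin.splitAt n

reverseˡ-involutive : ∀ n {t} (x : Fin (n + t)) → reverseˡ n (reverseˡ n x) ≡ x
reverseˡ-involutive n {t} x = begin
  Fin.join n t (Sum.map₁ opposite (Fin.splitAt n (Fin.join n t (Sum.map₁ opposite (Fin.splitAt n x)))))
    ≡⟨ cong (Fin.join n t ∘ Sum.map₁ opposite) (Fin.splitAt-join n t (Sum.map₁ opposite (Fin.splitAt n x))) ⟩
  Fin.join n t (Sum.map₁ opposite (Sum.map₁ opposite (Fin.splitAt n x)))
    ≡⟨ cong (Fin.join n t) (map₁-opposite-involutive (Fin.splitAt n x)) ⟩
  Fin.join n t (Fin.splitAt n x)
    ≡⟨ Fin.join-splitAt n t x ⟩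
  x ∎
  where
  open ≡-Reasoning
  map₁-opposite-involutive : (s : Fin n ⊎ Fin t) → Sum.map₁ opposite (Sum.map₁ opposite s) ≡ s
  map₁-opposite-involutive (inj₁ i) = cong inj₁ (Fin.opposite-involutive i)
  map₁-opposite-involutive (inj₂ j) = refl

module _ (n : ℕ) {t : ℕ} (p : Subset (n + t)) where

  take-preimage-reverseˡ : take n (preimage (reverseˡ n) p) ≡ reverse (take n p)
  take-preimage-reverseˡ = lookup-injective λ i → begin
    lookup (take n (preimage (reverseˡ n) p)) i ≡⟨ lookup-take n _ i ⟩
    lookup (preimage (reverseˡ n) p) (i ↑ˡ t)  ≡⟨ Vec.lookup∘tabulate _ (i ↑ˡ t) ⟩
    lookup p (reverseˡ n (i ↑ˡ t))             ≡⟨ cong (lookup p ∘ Fin.join n t ∘ Sum.map₁ opposite)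
                                                         (Fin.splitAt-↑ˡ n i t) ⟩
    lookup p (opposite i ↑ˡ t)                 ≡⟨ lookup-take n p (opposite i) ⟨
    lookup (take n p) (opposite i)             ≡⟨ lookup-reverse (take n p) i ⟨
    lookup (reverse (take n p)) i              ∎
    where open ≡-Reasoning

  drop-preimage-reverseˡ : drop n (preimage (reverseˡ n) p) ≡ drop n p
  drop-preimage-reverseˡ = lookup-injective λ j → begin
    lookup (drop n (preimage (reverseˡ n) p)) j ≡⟨ lookup-drop n _ j ⟩
    lookup (preimage (reverseˡ n) p) (n ↑ʳ j)  ≡⟨ Vec.lookup∘tabulate _ (n ↑ʳ j) ⟩
    lookup p (reverseˡ n (n ↑ʳ j))             ≡⟨ cong (lookup p ∘ Fin.join n t ∘ Sum.map₁ opposite)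
                                                         (Fin.splitAt-↑ʳ n t j) ⟩
    lookup p (n ↑ʳ j)                          ≡⟨ lookup-drop n p j ⟨
    lookup (drop n p) j                        ∎
    where open ≡-Reasoning

+-≤-complement : ∀ {a b a′ b′} → a + b ≡ a′ + b′ → a ≤ a′ → b′ ≤ b
+-≤-complement {a} {b} {a′} {b′} eq a≤a′ =
  ℕ.+-cancelˡ-≤ a b′ b (ℕ.≤-trans (ℕ.+-monoˡ-≤ b′ a≤a′) (ℕ.≤-reflexive (sym eq)))

reversedDualˡ : ∀ n {t} → Matroid (n + t) → Matroid (n + t)
reversedDualˡ n = relabel (reverseˡ n) (reverseˡ-involutive n) ∘ dual

module _ {n t : ℕ} (N : Matroid (n + t)) where

  private
    ψ : Subset (n + t) → Subset (n + t)
    ψ = ∁ ∘ preimage (reverseˡ n)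

    ψ-involutive : ∀ B → ψ (ψ B) ≡ B
    ψ-involutive B = begin
      ∁ (preimage (reverseˡ n) (∁ (preimage (reverseˡ n) B)))
        ≡⟨ cong ∁ (preimage-∁ (reverseˡ n) (preimage (reverseˡ n) B)) ⟩
      ∁ (∁ (preimage (reverseˡ n) (preimage (reverseˡ n) B)))
        ≡⟨ ∁-involutive _ ⟩
      preimage (reverseˡ n) (preimage (reverseˡ n) B)
        ≡⟨ preimage-involutive (reverseˡ-involutive n) B ⟩
      B ∎
      where open ≡-Reasoning

    basis-ψ : ∀ {C} → IsBasis N C → IsBasis (reversedDualˡ n N) (ψ C)
    basis-ψ {C} = subst (IsBasis N) (sym (ψ-involutive C))

    take-ψ : ∀ B → take n (ψ B) ≡ ∁reverse (take n B)
    take-ψ B = trans (Vec.take-map not n (preimage (reverseˡ n) B)) (cong ∁ (take-preimage-reverseˡ n B))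

    ∣take-ψ∣ : ∀ B → ∣ take n (ψ B) ∣ ≡ n ∸ ∣ take n B ∣
    ∣take-ψ∣ B = begin
      ∣ take n (ψ B) ∣           ≡⟨ cong ∣_∣ (take-ψ B) ⟩
      ∣ ∁ (reverse (take n B)) ∣ ≡⟨ Subset.∣∁p∣≡n∸∣p∣ (reverse (take n B)) ⟩
      n ∸ ∣ reverse (take n B) ∣ ≡⟨ cong (n ∸_) (∣reverse∣ (take n B)) ⟩
      n ∸ ∣ take n B ∣           ∎
      where open ≡-Reasoning

    ∣drop-ψ∣ : ∀ B → ∣ drop n (ψ B) ∣ ≡ t ∸ ∣ drop n B ∣
    ∣drop-ψ∣ B = begin
      ∣ drop n (ψ B) ∣                            ≡⟨ cong ∣_∣ (Vec.drop-map not n (preimage (reverseˡ n) B)) ⟩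
      ∣ ∁ (drop n (preimage (reverseˡ n) B)) ∣ ≡⟨ cong (∣_∣ ∘ ∁) (drop-preimage-reverseˡ n B) ⟩
      ∣ ∁ (drop n B) ∣                            ≡⟨ Subset.∣∁p∣≡n∸∣p∣ (drop n B) ⟩
      t ∸ ∣ drop n B ∣                            ∎
      where open ≡-Reasoning

    -- ψ turns μ into k ∸ μ, and on bases of N maximising ν means minimising μ, as μ + ν is the rank.
    module Maximality (μ ν : Subset (n + t) → ℕ) (k : ℕ) (μ∘ψ : ∀ B → μ (ψ B) ≡ k ∸ μ B)
                      (μ≤k : ∀ B → μ B ≤ k) (∣∣≡μ+ν : ∀ B → ∣ B ∣ ≡ μ B + ν B) where

      μ≤⇒ν≥ : ∀ {B B′} → IsBasis N B → IsBasis N B′ → μ B ≤ μ B′ → ν B′ ≤ ν B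
      μ≤⇒ν≥ {B} {B′} bB bB′ =
        +-≤-complement (trans (sym (∣∣≡μ+ν B)) (trans (bases-equicardinal N bB bB′) (∣∣≡μ+ν B′)))

      ν≤⇒μ≥ : ∀ {B B′} → IsBasis N B → IsBasis N B′ → ν B ≤ ν B′ → μ B′ ≤ μ B
      ν≤⇒μ≥ {B} {B′} bB bB′ = +-≤-complement (begin
        ν B + μ B   ≡⟨ ℕ.+-comm (ν B) (μ B) ⟩
        μ B + ν B   ≡⟨ ∣∣≡μ+ν B ⟨
        ∣ B ∣       ≡⟨ bases-equicardinal N bB bB′ ⟩
        ∣ B′ ∣      ≡⟨ ∣∣≡μ+ν B′ ⟩
        μ B′ + ν B′ ≡⟨ ℕ.+-comm (μ B′) (ν B′) ⟩
        ν B′ + μ B′ ∎)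
        where open ≡-Reasoning

      μ≡k∸μ∘ψ : ∀ B → μ B ≡ k ∸ μ (ψ B)
      μ≡k∸μ∘ψ B = trans (cong μ (sym (ψ-involutive B))) (μ∘ψ (ψ B))

      maximal⁺ : ∀ {B} → IsBasis N (ψ B) → (∀ B′ → IsBasis N (ψ B′) → μ B′ ≤ μ B) →
                 ∀ C → IsBasis N C → ν C ≤ ν (ψ B)
      maximal⁺ {B} bψB max C bC = μ≤⇒ν≥ bψB bC (ℕ.∸-cancelʳ-≤ (μ≤k (ψ B))
        (subst₂ _≤_ (μ∘ψ C) (μ≡k∸μ∘ψ B) (max (ψ C) (basis-ψ bC))))

      maximal⁻ : ∀ {C} → IsBasis N C → (∀ C′ → IsBasis N C′ → ν C′ ≤ ν C) →
                 ∀ B → IsBasis N (ψ B) → μ B ≤ μ (ψ C)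
      maximal⁻ {C} bC max B bψB = subst₂ _≤_ (sym (μ≡k∸μ∘ψ B)) (sym (μ∘ψ C))
        (ℕ.∸-monoʳ-≤ k (ν≤⇒μ≥ bψB bC (max (ψ B) bψB)))

      transfer : ∀ X →
        (Σ (Subset (n + t)) λ B → IsBasis N (ψ B) × take n B ≡ X ×
                                  (∀ B′ → IsBasis N (ψ B′) → μ B′ ≤ μ B)) ⇔
        (Σ (Subset (n + t)) λ C → IsBasis N C × take n C ≡ ∁reverse X ×
                                  (∀ C′ → IsBasis N C′ → ν C′ ≤ ν C))
      transfer X = mk⇔
        (λ (B , bψB , take≡X , max) → ψ B , bψB , trans (take-ψ B) (cong ∁reverse take≡X) , maximal⁺ bψB max)
        (λ (C , bC , take≡∁rX , max) →
          ψ C , basis-ψ bC , trans (take-ψ C) (trans (cong ∁reverse take≡∁rX) (∁reverse-involutive X)) ,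
          maximal⁻ bC max)

    module Take = Maximality (∣_∣ ∘ take n) (∣_∣ ∘ drop n) n ∣take-ψ∣ (Subset.∣p∣≤n ∘ take n)
                             (∣take∣+∣drop∣ n)
    module Drop = Maximality (∣_∣ ∘ drop n) (∣_∣ ∘ take n) t ∣drop-ψ∣ (Subset.∣p∣≤n ∘ drop n)
                             (λ B → trans (∣take∣+∣drop∣ n B) (ℕ.+-comm ∣ take n B ∣ ∣ drop n B ∣))

  deletion-reversedDualˡ : ∀ X →
    DeletionBasis {n} {t} (reversedDualˡ n N) X ⇔ ContractionBasis {n} {t} N (∁reverse X)
  deletion-reversedDualˡ = Take.transfer

  contraction-reversedDualˡ : ∀ X →
    ContractionBasis {n} {t} (reversedDualˡ n N) X ⇔ DeletionBasis {n} {t} N (∁reverse X)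
  contraction-reversedDualˡ = Drop.transfer


-- Lattice paths
positions : Subset n → List ℕ
positions []          = []
positions (true ∷ p)  = 0 ∷ List.map suc (positions p)
positions (false ∷ p) = List.map suc (positions p)

map-toℕ-elems     : (p : Subset n) → List.map toℕ (elems p) ≡ positions p
map-toℕ-suc-elems : (p : Subset n) → List.map toℕ (List.map Fin.suc (elems p)) ≡ List.map suc (positions p)

map-toℕ-elems []          = refl
map-toℕ-elems (true ∷ p)  = cong (0 ∷_) (map-toℕ-suc-elems p)
map-toℕ-elems (false ∷ p) = map-toℕ-suc-elems p

map-toℕ-suc-elems p = begin
  List.map toℕ (List.map Fin.suc (elems p)) ≡⟨ List.map-∘ (elems p) ⟨
  List.map (suc ∘ toℕ) (elems p)            ≡⟨ List.map-∘ (elems p) ⟩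
  List.map suc (List.map toℕ (elems p))     ≡⟨ cong (List.map suc) (map-toℕ-elems p) ⟩
  List.map suc (positions p)                ∎
  where open ≡-Reasoning

data Step : ℕ → ℕ → Bool → Bool → Set where
  both-out : ∀ {d} → Step d d false false
  both-in  : ∀ {d} → Step d d true true
  gain     : ∀ {d} → Step d (suc d) true false
  lose     : ∀ {d} → Step (suc d) d false true

-- Lead d e p q: scanning p and q from the left, #p − #q on the prefix read so far starts at d,
-- ends at e and never drops below 0.
data Lead : ℕ → ℕ → Subset n → Subset n → Set where
  []  : ∀ {d} → Lead d d [] []
  _∷_ : ∀ {d d′ e u b} {p q : Subset n} → Step d d′ u b → Lead d′ e p q → Lead d e (u ∷ p) (b ∷ q)

Lead-∷ʳ : ∀ {d e e′ u b} {p q : Subset n} → Lead d e p q → Step e e′ u b → Lead d e′ (p ∷ʳ u) (q ∷ʳ b)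
Lead-∷ʳ []          step = step ∷ []
Lead-∷ʳ (step′ ∷ l) step = step′ ∷ Lead-∷ʳ l step

Step-∁reverse : ∀ {d d′ u b} → Step d d′ u b → Step d′ d (not u) (not b)
Step-∁reverse both-out = both-in
Step-∁reverse both-in  = both-out
Step-∁reverse gain     = lose
Step-∁reverse lose     = gain

Lead-∁reverse : ∀ {d e} {p q : Subset n} → Lead d e p q → Lead e d (∁reverse p) (∁reverse q)
Lead-∁reverse []                            = []
Lead-∁reverse {p = u ∷ p} {b ∷ q} (step ∷ l) =
  subst₂ (Lead _ _) (sym (∁reverse-∷ u p)) (sym (∁reverse-∷ b q)) (Lead-∷ʳ (Lead-∁reverse l) (Step-∁reverse step))

private
  Pw : List ℕ → List ℕ → Set
  Pw = Pointwise _≤_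

  pad : ℕ → List ℕ
  pad d = List.replicate d 0

  pad-suc : ∀ d xs → pad d ++ 0 ∷ xs ≡ pad (suc d) ++ xs
  pad-suc zero    xs = refl
  pad-suc (suc d) xs = cong (0 ∷_) (pad-suc d xs)

  shift⁻ : ∀ d xs ys → Pw (pad d ++ List.map suc xs) (List.map suc ys) → Pw (pad d ++ xs) ys
  shift⁻ zero    []       []       []           = []
  shift⁻ zero    (x ∷ xs) (y ∷ ys) (s≤s r ∷ rs) = r ∷ shift⁻ zero xs ys rs
  shift⁻ (suc d) xs       (y ∷ ys) (_ ∷ rs)     = z≤n ∷ shift⁻ d xs ys rs

  shift⁺ : ∀ d xs ys → Pw (pad d ++ xs) ys → Pw (pad d ++ List.map suc xs) (List.map suc ys)
  shift⁺ zero    []       []       []       = []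
  shift⁺ zero    (x ∷ xs) (y ∷ ys) (r ∷ rs) = s≤s r ∷ shift⁺ zero xs ys rs
  shift⁺ (suc d) xs       (y ∷ ys) (_ ∷ rs) = z≤n ∷ shift⁺ d xs ys rs

  -- The d zeros of pad d stand for elements of p already read but not yet matched in q.
  Pw⇒Lead : ∀ d (p q : Subset n) → Pw (pad d ++ positions p) (positions q) → Lead d 0 p q
  Pw⇒Lead zero    []          []          _ = []
  Pw⇒Lead (suc d) []          []          ()
  Pw⇒Lead d       (false ∷ p) (false ∷ q) r = both-out ∷ Pw⇒Lead d p q (shift⁻ d _ _ r)
  Pw⇒Lead d       (true ∷ p)  (false ∷ q) r =
    gain ∷ Pw⇒Lead (suc d) p q (shift⁻ (suc d) _ _ (subst (λ xs → Pw xs _) (pad-suc d _) r))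
  Pw⇒Lead d       (true ∷ p)  (true ∷ q)  r with subst (λ xs → Pw xs _) (pad-suc d _) r
  ... | _ ∷ r′ = both-in ∷ Pw⇒Lead d p q (shift⁻ d _ _ r′)
  Pw⇒Lead (suc d) (false ∷ p) (true ∷ q)  (_ ∷ r) = lose ∷ Pw⇒Lead d p q (shift⁻ d _ _ r)
  Pw⇒Lead zero    (false ∷ p) (true ∷ q)  r with positions p | r
  ... | []    | ()
  ... | _ ∷ _ | () ∷ _

  Lead⇒Pw : ∀ {d} {p q : Subset n} → Lead d 0 p q → Pw (pad d ++ positions p) (positions q)
  Lead⇒Pw []                 = []
  Lead⇒Pw {d = d} (both-out ∷ l) = shift⁺ d _ _ (Lead⇒Pw l)
  Lead⇒Pw {d = d} (both-in ∷ l)  = subst (λ xs → Pw xs _) (sym (pad-suc d _)) (z≤n ∷ shift⁺ d _ _ (Lead⇒Pw l))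
  Lead⇒Pw {d = d} (gain ∷ l)     = subst (λ xs → Pw xs _) (sym (pad-suc d _)) (shift⁺ (suc d) _ _ (Lead⇒Pw l))
  Lead⇒Pw {d = suc d} (lose ∷ l) = z≤n ∷ shift⁺ d _ _ (Lead⇒Pw l)

≼⇒Lead : ∀ {p q : Subset n} → p ≼ q → Lead 0 0 p q
≼⇒Lead {p = p} {q} p≼q =
  Pw⇒Lead 0 p q (subst₂ Pw (map-toℕ-elems p) (map-toℕ-elems q) (Pointwise.map⁺ toℕ toℕ p≼q))

Lead⇒≼ : ∀ {p q : Subset n} → Lead 0 0 p q → p ≼ q
Lead⇒≼ {p = p} {q} l =
  Pointwise.map⁻ toℕ toℕ (subst₂ Pw (sym (map-toℕ-elems p)) (sym (map-toℕ-elems q)) (Lead⇒Pw l))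

≼-∁reverse : ∀ {p q : Subset n} → p ≼ q → ∁reverse p ≼ ∁reverse q
≼-∁reverse {p = p} {q} p≼q = Lead⇒≼ (Lead-∁reverse (≼⇒Lead {p = p} {q} p≼q))


-- Lattice path matroids
reversedDual : LPM n → LPM n
reversedDual M = M[ ∁reverse (U M) , ∁reverse (L M) ]⟨ ≼-∁reverse {p = U M} {L M} (U≼L M) ⟩

LPMBasis-reversedDual : ∀ (M : LPM n) X → LPMBasis (reversedDual M) X ⇔ LPMBasis M (∁reverse X)
LPMBasis-reversedDual M X = mk⇔
  (λ (U′≼X , X≼L′) →
    subst (_≼ ∁reverse X) (∁reverse-involutive (U M)) (≼-∁reverse {p = ∁reverse (U M)} {X} U′≼X) ,
    subst (∁reverse X ≼_) (∁reverse-involutive (L M)) (≼-∁reverse {p = X} {∁reverse (L M)} X≼L′))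
  (λ (U≼X′ , X′≼L) →
    subst (∁reverse (U M) ≼_) (∁reverse-involutive X) (≼-∁reverse {p = U M} {∁reverse X} U≼X′) ,
    subst (_≼ ∁reverse (L M)) (∁reverse-involutive X) (≼-∁reverse {p = ∁reverse X} {L M} X′≼L))

≤q-antitone : {M′ M : LPM n} → M′ ≤q M → reversedDual M ≤q reversedDual M′
≤q-antitone {n} {M′} {M} (t , N , deletion , contraction) = t , reversedDualˡ n N , deletion′ , contraction′
  where
  open Equivalence
  deletion′ : ∀ X → (LPMBasis (reversedDual M′) X → DeletionBasis (reversedDualˡ n N) X) ×
                    (DeletionBasis (reversedDualˡ n N) X → LPMBasis (reversedDual M′) X)
  deletion′ X =
    from (deletion-reversedDualˡ N X) ∘ proj₁ (contraction (∁reverse X)) ∘ to (LPMBasis-reversedDual M′ X) ,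
    from (LPMBasis-reversedDual M′ X) ∘ proj₂ (contraction (∁reverse X)) ∘ to (deletion-reversedDualˡ N X)
  contraction′ : ∀ X → (LPMBasis (reversedDual M) X → ContractionBasis (reversedDualˡ n N) X) ×
                       (ContractionBasis (reversedDualˡ n N) X → LPMBasis (reversedDual M) X)
  contraction′ X =
    from (contraction-reversedDualˡ N X) ∘ proj₁ (deletion (∁reverse X)) ∘ to (LPMBasis-reversedDual M X) ,
    from (LPMBasis-reversedDual M X) ∘ proj₂ (deletion (∁reverse X)) ∘ to (contraction-reversedDualˡ N X)

LPMBasis-resp-≈M : ∀ (A A′ : LPM n) X → A ≈M A′ → LPMBasis A X → LPMBasis A′ X
LPMBasis-resp-≈M A A′ X (refl , refl) = id

≈M-sym : ∀ {A A′ : LPM n} → A ≈M A′ → A′ ≈M A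
≈M-sym (eU , eL) = sym eU , sym eL

≤q-resp-≈M : ∀ {A A′ B B′ : LPM n} → A ≈M A′ → B ≈M B′ → A ≤q B → A′ ≤q B′
≤q-resp-≈M {A = A} {A′} {B} {B′} A≈A′ B≈B′ (t , N , deletion , contraction) = t , N ,
  (λ X → proj₁ (deletion X) ∘ LPMBasis-resp-≈M B′ B X (≈M-sym {A = B} {B′} B≈B′) ,
         LPMBasis-resp-≈M B B′ X B≈B′ ∘ proj₂ (deletion X)) ,
  (λ X → proj₁ (contraction X) ∘ LPMBasis-resp-≈M A′ A X (≈M-sym {A = A} {A′} A≈A′) ,
         LPMBasis-resp-≈M A A′ X A≈A′ ∘ proj₂ (contraction X))

reversedDual-involutive : (M : LPM n) → reversedDual (reversedDual M) ≈M M
reversedDual-involutive M = ∁reverse-involutive (U M) , ∁reverse-involutive (L M)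

reversedDual-swap : ∀ {A B : LPM n} → reversedDual A ≈M B → A ≈M reversedDual B
reversedDual-swap (eU , eL) = ∁reverse-swap eU , ∁reverse-swap eL

≤q-swapˡ : ∀ {A B : LPM n} → reversedDual A ≤q B → reversedDual B ≤q A
≤q-swapˡ {A = A} {B} rA≤B = ≤q-resp-≈M {A = reversedDual B} {reversedDual B} {reversedDual (reversedDual A)} {A}
  (refl , refl) (reversedDual-involutive A) (≤q-antitone {M′ = reversedDual A} {B} rA≤B)

≤q-swapʳ : ∀ {A B : LPM n} → A ≤q reversedDual B → B ≤q reversedDual A
≤q-swapʳ {A = A} {B} A≤rB = ≤q-resp-≈M {A = reversedDual (reversedDual B)} {B} {reversedDual A} {reversedDual A}
  (reversedDual-involutive B) (refl , refl) (≤q-antitone {M′ = A} {reversedDual B} A≤rB)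

⋖-antitone : ∀ {M′ M : LPM n} → M′ ⋖ M → reversedDual M ⋖ reversedDual M′
⋖-antitone {M′ = M′} {M} (M′≤M , M′≉M , between) = ≤q-antitone {M′ = M′} {M} M′≤M , ≉ , between′
  where
  ≉ : ¬ (reversedDual M ≈M reversedDual M′)
  ≉ (eU , eL) = M′≉M (sym (trans (∁reverse-swap eU) (∁reverse-involutive (U M′))) ,
                      sym (trans (∁reverse-swap eL) (∁reverse-involutive (L M′))))
  between′ : ∀ M″ → reversedDual M ≤q M″ → M″ ≤q reversedDual M′ →
             M″ ≈M reversedDual M ⊎ M″ ≈M reversedDual M′
  between′ M″ M≤M″ M″≤M′ =
    Sum.swap (Sum.map (reversedDual-swap {A = M″} {M′}) (reversedDual-swap {A = M″} {M})
      (between (reversedDual M″) (≤q-swapʳ {A = M″} {M′} M″≤M′) (≤q-swapˡ {A = M} {M″} M≤M″)))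


-- Conjugation by the longest permutation
opposite-injective : ∀ {i j : Fin n} → opposite i ≡ opposite j → i ≡ j
opposite-injective {i = i} {j} eq =
  trans (sym (Fin.opposite-involutive i)) (trans (cong opposite eq) (Fin.opposite-involutive j))

opposite-<⁻ : ∀ {i j : Fin n} → opposite i Fin.< opposite j → j Fin.< i
opposite-<⁻ {n} {i} {j} oi<oj =
  ℕ.≤-pred (ℕ.∸-cancelʳ-< {o = n} (subst₂ _<_ (Fin.opposite-prop i) (Fin.opposite-prop j) oi<oj))

opposite-suc : ∀ {i j : Fin n} → suc (toℕ i) ≡ toℕ j → suc (toℕ (opposite j)) ≡ toℕ (opposite i)
opposite-suc {n} {i} {j} i+1≡j = begin
  suc (toℕ (opposite j)) ≡⟨ cong suc (Fin.opposite-prop j) ⟩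
  suc (n ∸ suc (toℕ j))  ≡⟨ ℕ.+-∸-assoc 1 (Fin.toℕ<n j) ⟨
  n ∸ toℕ j              ≡⟨ cong (n ∸_) i+1≡j ⟨
  n ∸ suc (toℕ i)        ≡⟨ Fin.opposite-prop i ⟨
  toℕ (opposite i)       ∎
  where open ≡-Reasoning

opposite-inject₁ : (i : Fin n) → opposite (Fin.inject₁ i) ≡ Fin.suc (opposite i)
opposite-inject₁ {suc n} Fin.zero    = refl
opposite-inject₁ {suc n} (Fin.suc i) = cong Fin.inject₁ (opposite-inject₁ i)

w₀-conjugate : Vec (Fin n) n → Vec (Fin n) n
w₀-conjugate τ = tabulate (opposite ∘ lookup τ ∘ opposite)

lookup-w₀-conjugate : ∀ (τ : Vec (Fin n) n) i → lookup (w₀-conjugate τ) i ≡ opposite (lookup τ (opposite i))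
lookup-w₀-conjugate τ = Vec.lookup∘tabulate (opposite ∘ lookup τ ∘ opposite)

w₀-conjugate-involutive : (τ : Vec (Fin n) n) → w₀-conjugate (w₀-conjugate τ) ≡ τ
w₀-conjugate-involutive τ = lookup-injective λ i → begin
  lookup (w₀-conjugate (w₀-conjugate τ)) i             ≡⟨ lookup-w₀-conjugate (w₀-conjugate τ) i ⟩
  opposite (lookup (w₀-conjugate τ) (opposite i))      ≡⟨ cong opposite (lookup-w₀-conjugate τ (opposite i)) ⟩
  opposite (opposite (lookup τ (opposite (opposite i)))) ≡⟨ Fin.opposite-involutive _ ⟩
  lookup τ (opposite (opposite i))                     ≡⟨ cong (lookup τ) (Fin.opposite-involutive i) ⟩
  lookup τ i                                           ∎
  where open ≡-Reasoning

IsPerm-w₀-conjugate : {τ : Vec (Fin n) n} → IsPerm τ → IsPerm (w₀-conjugate τ)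
IsPerm-w₀-conjugate {τ = τ} τ-injective i j eq = opposite-injective (τ-injective (opposite i) (opposite j)
  (opposite-injective (trans (sym (lookup-w₀-conjugate τ i)) (trans eq (lookup-w₀-conjugate τ j)))))

Falling-w₀-conjugate : {σ τ : Vec (Fin n) n} → Falling σ τ → Falling (w₀-conjugate σ) (w₀-conjugate τ)
Falling-w₀-conjugate {σ = σ} {τ} falling i j i+1≡j (σ′i<σ′j , τ′i<τ′j) =
  falling (opposite j) (opposite i) (opposite-suc i+1≡j) (reversed σ σ′i<σ′j , reversed τ τ′i<τ′j)
  where
  reversed : ∀ π → lookup (w₀-conjugate π) i Fin.< lookup (w₀-conjugate π) j →
             lookup π (opposite j) Fin.< lookup π (opposite i)
  reversed π = opposite-<⁻ ∘ subst₂ Fin._<_ (lookup-w₀-conjugate π i) (lookup-w₀-conjugate π j)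

IsChainWithLabels-reverse : ∀ {σ τ : Vec (Fin n) n} {M : Fin (suc n) → LPM n} → IsChainWithLabels σ τ M →
  IsChainWithLabels (w₀-conjugate σ) (w₀-conjugate τ) (reversedDual ∘ M ∘ opposite)
IsChainWithLabels-reverse {n} {σ} {τ} {M} ((U₀ , L₀) , (Uₙ , Lₙ) , steps) = bottom , top , steps′
  where
  bottom : U (reversedDual (M (Fin.fromℕ n))) ≡ ⊥ × L (reversedDual (M (Fin.fromℕ n))) ≡ ⊥
  bottom = trans (cong ∁reverse Uₙ) (∁reverse-replicate true) , trans (cong ∁reverse Lₙ) (∁reverse-replicate true)

  top : U (reversedDual (M (opposite (Fin.fromℕ n)))) ≡ ⊤ × L (reversedDual (M (opposite (Fin.fromℕ n)))) ≡ ⊤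
  top rewrite Fin.opposite-involutive {suc n} Fin.zero =
    trans (cong ∁reverse U₀) (∁reverse-replicate false) , trans (cong ∁reverse L₀) (∁reverse-replicate false)

  steps′ : ∀ j →
    reversedDual (M (opposite (Fin.inject₁ j))) ⋖ reversedDual (M (opposite (Fin.suc j))) ×
    lookup (w₀-conjugate τ) j ∈ U (reversedDual (M (opposite (Fin.suc j)))) ×
    lookup (w₀-conjugate σ) j ∈ L (reversedDual (M (opposite (Fin.suc j)))) ×
    U (reversedDual (M (opposite (Fin.inject₁ j)))) ≡
      U (reversedDual (M (opposite (Fin.suc j)))) - lookup (w₀-conjugate τ) j ×
    L (reversedDual (M (opposite (Fin.inject₁ j)))) ≡
      L (reversedDual (M (opposite (Fin.suc j)))) - lookup (w₀-conjugate σ) j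
  steps′ j rewrite opposite-inject₁ j | lookup-w₀-conjugate τ j | lookup-w₀-conjugate σ j with steps (opposite j)
  ... | M₋⋖M₊ , τ∈ , σ∈ , U₋≡ , L₋≡ with ∁reverse-step τ∈ U₋≡ | ∁reverse-step σ∈ L₋≡
  ... | τ′∈ , U′≡ | σ′∈ , L′≡ =
    ⋖-antitone {M′ = M (Fin.inject₁ (opposite j))} {M (Fin.suc (opposite j))} M₋⋖M₊ , τ′∈ , σ′∈ , U′≡ , L′≡

InCσ-w₀-conjugate : {σ τ : Vec (Fin n) n} → InCσ σ τ → InCσ (w₀-conjugate σ) (w₀-conjugate τ)
InCσ-w₀-conjugate {σ = σ} {τ} (falling , M , chain) =
  Falling-w₀-conjugate {σ = σ} {τ} falling ,
  reversedDual ∘ M ∘ opposite , IsChainWithLabels-reverse {σ = σ} {τ} {M} chain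


Cσ-w₀-conjugate : ∀ {σ σ′ τ : Vec (Fin n) n} → σ′ ≡ w₀-conjugate σ → IsPerm τ → InCσ σ τ →
                  IsPerm (w₀-conjugate τ) × InCσ σ′ (w₀-conjugate τ) × w₀-conjugate (w₀-conjugate τ) ≡ τ
Cσ-w₀-conjugate {σ = σ} {τ = τ} refl τ-perm τ∈Cσ =
  IsPerm-w₀-conjugate {τ = τ} τ-perm , InCσ-w₀-conjugate {σ = σ} {τ} τ∈Cσ , w₀-conjugate-involutive τ


-- Reduced words
module _ {k x : ℕ} where

  s-lower : suc x ≡ k → s k x ≡ k
  s-lower x+1≡k rewrite dec-true (x + 1 ℕ.≟ k) (trans (ℕ.+-comm x 1) x+1≡k) = refl

  s-upper : x ≡ k → s k x ≡ k ∸ 1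
  s-upper x≡k rewrite dec-false (x + 1 ℕ.≟ k) (λ x+1≡k → ℕ.m+1+n≢m x (trans x+1≡k (sym x≡k)))
                    | dec-true (x ℕ.≟ k) x≡k = refl

  s-fixed : suc x ≢ k → x ≢ k → s k x ≡ x
  s-fixed x+1≢k x≢k rewrite dec-false (x + 1 ℕ.≟ k) (x+1≢k ∘ trans (ℕ.+-comm 1 x))
                          | dec-false (x ℕ.≟ k) x≢k = refl

data SView (k x : ℕ) : ℕ → Set where
  lower : suc x ≡ k → SView k x k
  upper : x ≡ k → SView k x (k ∸ 1)
  fixed : suc x ≢ k → x ≢ k → SView k x x

s-view : ∀ k x → SView k x (s k x)
s-view k x with suc x ℕ.≟ k | x ℕ.≟ k
... | yes x+1≡k | _       = subst (SView k x) (sym (s-lower x+1≡k)) (lower x+1≡k)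
... | no  x+1≢k | yes x≡k = subst (SView k x) (sym (s-upper x≡k)) (upper x≡k)
... | no  x+1≢k | no  x≢k = subst (SView k x) (sym (s-fixed x+1≢k x≢k)) (fixed x+1≢k x≢k)

s-bound : ∀ {n k y} → k < n → y < n → s k y < n
s-bound {k = k} {y} k<n y<n with s k y | s-view k y
... | _ | lower _   = k<n
... | _ | upper _   = ℕ.≤-<-trans (ℕ.m∸n≤m k 1) k<n
... | _ | fixed _ _ = y<n

-- w₀ n acts on the 0-based values used by s, as opposite does on Fin n.
w₀ : ℕ → ℕ → ℕ
w₀ n x = n ∸ suc x

suc-w₀ : ∀ {n y} → y < n → suc (w₀ n y) ≡ n ∸ y
suc-w₀ y<n = sym (ℕ.+-∸-assoc 1 y<n)

s-conjugate : ∀ {n k y} → 1 ≤ k → k < n → y < n → s (n ∸ k) (w₀ n y) ≡ w₀ n (s k y)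
s-conjugate {n} {k} {y} 1≤k k<n y<n with s k y | s-view k y
... | _ | lower refl = begin
  s (n ∸ suc y) (n ∸ suc y) ≡⟨ s-upper {n ∸ suc y} refl ⟩
  n ∸ suc y ∸ 1             ≡⟨ ℕ.∸-+-assoc n (suc y) 1 ⟩
  n ∸ (suc y + 1)           ≡⟨ cong (n ∸_) (ℕ.+-comm (suc y) 1) ⟩
  w₀ n (suc y)              ∎
  where open ≡-Reasoning
... | _ | upper refl = begin
  s (n ∸ y) (w₀ n y) ≡⟨ s-lower {n ∸ y} (suc-w₀ y<n) ⟩
  n ∸ y              ≡⟨ cong (n ∸_) (ℕ.m∸n+n≡m 1≤k) ⟨
  n ∸ (y ∸ 1 + 1)    ≡⟨ cong (n ∸_) (ℕ.+-comm (y ∸ 1) 1) ⟩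
  w₀ n (y ∸ 1)       ∎
  where open ≡-Reasoning
... | _ | fixed y+1≢k y≢k = s-fixed
  (λ eq → y≢k (ℕ.∸-cancelˡ-≡ (ℕ.<⇒≤ y<n) (ℕ.<⇒≤ k<n) (trans (sym (suc-w₀ y<n)) eq)))
  (λ eq → y+1≢k (ℕ.∸-cancelˡ-≡ y<n (ℕ.<⇒≤ k<n) eq))

word-bound : ∀ {n w x} → ValidWord n w → x < n → word w x < n
word-bound []                  x<n = x<n
word-bound ((_ , k<n) ∷ valid) x<n = s-bound k<n (word-bound valid x<n)

w₀<n : ∀ {n x} → x < n → w₀ n x < n
w₀<n {suc n} {x} _ = s≤s (ℕ.m∸n≤m n x)

word-flipWord : ∀ {n w x} → ValidWord n w → x < n → word (flipWord n w) x ≡ w₀ n (word w (w₀ n x))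
word-flipWord {n} {[]}    {x} []                    x<n =
  sym (trans (cong (n ∸_) (suc-w₀ x<n)) (ℕ.m∸[m∸n]≡n (ℕ.<⇒≤ x<n)))
word-flipWord {n} {k ∷ w} {x} ((1≤k , k<n) ∷ valid) x<n =
  trans (cong (s (n ∸ k)) (word-flipWord valid x<n)) (s-conjugate 1≤k k<n (word-bound valid (w₀<n x<n)))

flipWord-w₀-conjugate : ∀ {σ σ′ : Vec (Fin n) n} {w} → ValidWord n w →
  (∀ i → toℕ (lookup σ i) ≡ word w (toℕ i)) →
  (∀ i → toℕ (lookup σ′ i) ≡ word (flipWord n w) (toℕ i)) →
  σ′ ≡ w₀-conjugate σ
flipWord-w₀-conjugate {n} {σ} {σ′} {w} valid σ≡w σ′≡w′ = lookup-injective λ i → Fin.toℕ-injective (begin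
  toℕ (lookup σ′ i)                         ≡⟨ σ′≡w′ i ⟩
  word (flipWord n w) (toℕ i)               ≡⟨ word-flipWord valid (Fin.toℕ<n i) ⟩
  w₀ n (word w (w₀ n (toℕ i)))              ≡⟨ cong (w₀ n ∘ word w) (Fin.opposite-prop i) ⟨
  w₀ n (word w (toℕ (opposite i)))          ≡⟨ cong (w₀ n) (σ≡w (opposite i)) ⟨
  w₀ n (toℕ (lookup σ (opposite i)))        ≡⟨ Fin.opposite-prop _ ⟨
  toℕ (opposite (lookup σ (opposite i)))    ≡⟨ cong toℕ (lookup-w₀-conjugate σ i) ⟨
  toℕ (lookup (w₀-conjugate σ) i)           ∎)
  where open ≡-Reasoning

proposition3p16 : (n : ℕ) → 1 ≤ n → (σ σ′ : Vec (Fin n) n) → (w : List ℕ) →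
    ReducedWordFor w σ → ReducedWordFor (flipWord n w) σ′ →
    Σ (Vec (Fin n) n → Vec (Fin n) n) λ f → Σ (Vec (Fin n) n → Vec (Fin n) n) λ g →
      ((τ : Vec (Fin n) n) → IsPerm τ → InCσ σ τ →
        IsPerm (f τ) × InCσ σ′ (f τ) × g (f τ) ≡ τ) ×
      ((τ : Vec (Fin n) n) → IsPerm τ → InCσ σ′ τ →
        IsPerm (g τ) × InCσ σ (g τ) × f (g τ) ≡ τ)
proposition3p16 n _ σ σ′ w (valid , σ≡w , _) (_ , σ′≡w′ , _) = w₀-conjugate , w₀-conjugate ,
  (λ τ → Cσ-w₀-conjugate {σ = σ} {σ′} {τ} σ′≡w₀σw₀) ,
  (λ τ → Cσ-w₀-conjugate {σ = σ′} {σ} {τ} σ≡w₀σ′w₀)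
  where
  σ′≡w₀σw₀ : σ′ ≡ w₀-conjugate σ
  σ′≡w₀σw₀ = flipWord-w₀-conjugate {σ = σ} {σ′} {w} valid σ≡w σ′≡w′

  σ≡w₀σ′w₀ : σ ≡ w₀-conjugate σ′
  σ≡w₀σ′w₀ = trans (sym (w₀-conjugate-involutive σ)) (cong w₀-conjugate (sym σ′≡w₀σw₀))
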